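{- Let $S^1$ be the circle type and $\mathrm{base}:S^1$ its base point. Then $\Pi_1(S^1,\mathrm{base})\simeq\mathbb{Z}$: there are mutually inverse functions $\Pi_1(S^1,\mathrm{base})\to\mathbb{Z}$ and $\mathbb{Z}\to\Pi_1(S^1,\mathrm{base})$.
   Context: Computational paths: in Martin-Löf type theory, for terms $a,b:A$ a computational path $a=_s b:A$ is a finite composition of rewrites, each an application of an axiom or inference rule of the $\lambda\beta\eta$-equality theory of type theory. These include reflexivity $a=_{\rho}a$; symmetry, which from $a=_s b$ gives $b=_{\sigma(s)}a$; and transitivity, which from $a=_s b$ and $b=_t c$ gives $a=_{\tau(s,t)}c$. Paths are compared up to rw-equality $=_{rw}$: the reflexive, symmetric and transitive closure of the rewrite system $LND_{EQ}$-$TRS$, whose rules include $\sigma(\rho)\rhd\rho$, $\sigma(\sigma(r))\rhd r$, $\tau(r,\sigma(r))\rhd\rho$, $\tau(\sigma(r),r)\rhd\rho$, $\tau(r,\rho)\rhd r$, $\tau(\rho,r)\rhd r$, and $\tau(\tau(t,r),s)\rhd\tau(t,\tau(r,s))$. The circle $S^1$ is the type generated by a point $\mathrm{base}:S^1$ and a computational path $\mathrm{base}=_{loop}\mathrm{base}:S^1$. Its other paths are obtained from $loop$ by applying $\rho$, $\sigma$ and $\tau$. For a type $A$ and a point $a:A$, $\Pi_1(A,a)=\{[l]_{rw}\mid a=_l a:A\}$ is the set of rw-equivalence classes of computational paths from $a$ to $a$. Its operation is $r\circ s:=\tau(s,r)$. -}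

module Defs where

open import Relation.Binary.Bundles using (Setoid)
open import Relation.Binary.Construct.Closure.Equivalence using (EqClosure; setoid)

-- Computational paths base = base in the circle S¹.
-- They are generated from loop by ρ (reflexivity), σ (symmetry), τ (transitivity).
-- (Every path here has endpoints base, base, so no indices are needed.)
data Path : Set where
  loop : Path
  ρ    : Path
  σ    : Path → Path
  τ    : Path → Path → Path

-- One-step rewriting of the LND_EQ-TRS rules relevant to ρ, σ, τ,
-- applied anywhere inside a term (closure under contexts).
infix 4 _▷_
data _▷_ : Path → Path → Set where
  σρ     : σ ρ ▷ ρ
  σσ     : ∀ r → σ (σ r) ▷ r
  τrσr   : ∀ r → τ r (σ r) ▷ ρ
  τσrr   : ∀ r → τ (σ r) r ▷ ρ
  τrρ    : ∀ r → τ r ρ ▷ r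
  τρr    : ∀ r → τ ρ r ▷ r
  ττ     : ∀ t r s → τ (τ t r) s ▷ τ t (τ r s)
  cong-σ  : ∀ {r r'} → r ▷ r' → σ r ▷ σ r'
  cong-τˡ : ∀ {r r' s} → r ▷ r' → τ r s ▷ τ r' s
  cong-τʳ : ∀ {r s s'} → s ▷ s' → τ r s ▷ τ r s'

infix 4 _=rw_
_=rw_ : Path → Path → Set
_=rw_ = EqClosure _▷_

-- Π₁(S¹, base): paths base = base up to rw-equality (as a setoid, quotients
-- being unavailable in --safe --without-K Agda).
Π₁S¹ : Setoid _ _
Π₁S¹ = setoid _▷_

module Submission where

-- Read loop, ρ, σ, τ as 1, 0, -, + in ℤ: every rewrite rule becomes a group
-- law, so this winding number is invariant under rw-equality. Conversely
-- loop^ z, the z-fold composite of loop or of σ loop, turns + and - into τ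
-- and σ up to rw-equality, so by induction on paths every path is rw-equal
-- to loop^ of its winding number.

open import Defs
open import Data.Integer using (ℤ)
open import Function.Bundles using (Inverse)
open import Relation.Binary.PropositionalEquality using (setoid)

open import Data.Integer using (+_; -[1+_]; 0ℤ; 1ℤ; _+_; -_; suc; pred)
open import Data.Integer.Properties
  using (neg-involutive; +-inverseˡ; +-inverseʳ; +-identityˡ; +-identityʳ; +-assoc; suc-+; pred-+)
open import Data.Nat using (ℕ; zero) renaming (suc to 1+)
open import Data.Product using (_,_)
open import Relation.Binary.PropositionalEquality as ≡ using (_≡_; refl)
open import Relation.Binary.Construct.Closure.Equivalence using (gfold; gmap; return)
open import Relation.Binary.Bundles using (Setoid)

open Setoid Π₁S¹ using () renaming (refl to rw-refl; reflexive to ≡⇒=rw)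
open import Relation.Binary.Reasoning.Setoid Π₁S¹

▷⇒=rw : ∀ {r s} → r ▷ s → r =rw s
▷⇒=rw = return

σ-cong : ∀ {r r′} → r =rw r′ → σ r =rw σ r′
σ-cong = gmap σ cong-σ

τ-congˡ : ∀ {r r′ s} → r =rw r′ → τ r s =rw τ r′ s
τ-congˡ {s = s} = gmap (λ r → τ r s) cong-τˡ

τ-congʳ : ∀ {r s s′} → s =rw s′ → τ r s =rw τ r s′
τ-congʳ {r = r} = gmap (τ r) cong-τʳ

τ-cancelˡ : ∀ r s → τ r (τ (σ r) s) =rw s
τ-cancelˡ r s = begin
  τ r (τ (σ r) s)  ≈⟨ ▷⇒=rw (ττ r (σ r) s) ⟨
  τ (τ r (σ r)) s  ≈⟨ τ-congˡ (▷⇒=rw (τrσr r)) ⟩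
  τ ρ s            ≈⟨ ▷⇒=rw (τρr s) ⟩
  s                ∎

σ-cancelˡ : ∀ r s → τ (σ r) (τ r s) =rw s
σ-cancelˡ r s = begin
  τ (σ r) (τ r s)  ≈⟨ ▷⇒=rw (ττ (σ r) r s) ⟨
  τ (τ (σ r) r) s  ≈⟨ τ-congˡ (▷⇒=rw (τσrr r)) ⟩
  τ ρ s            ≈⟨ ▷⇒=rw (τρr s) ⟩
  s                ∎

inverse-unique : ∀ {r s} → τ r s =rw ρ → s =rw σ r
inverse-unique {r} {s} rs=ρ = begin
  s                ≈⟨ σ-cancelˡ r s ⟨
  τ (σ r) (τ r s)  ≈⟨ τ-congʳ rs=ρ ⟩
  τ (σ r) ρ        ≈⟨ ▷⇒=rw (τrρ (σ r)) ⟩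
  σ r              ∎

winding : Path → ℤ
winding loop    = 1ℤ
winding ρ       = 0ℤ
winding (σ r)   = - winding r
winding (τ r s) = winding r + winding s

winding-resp-▷ : ∀ {r s} → r ▷ s → winding r ≡ winding s
winding-resp-▷ σρ                        = refl
winding-resp-▷ (σσ r)                    = neg-involutive (winding r)
winding-resp-▷ (τrσr r)                  = +-inverseʳ (winding r)
winding-resp-▷ (τσrr r)                  = +-inverseˡ (winding r)
winding-resp-▷ (τrρ r)                   = +-identityʳ (winding r)
winding-resp-▷ (τρr r)                   = +-identityˡ (winding r)
winding-resp-▷ (ττ t r s)                = +-assoc (winding t) (winding r) (winding s)
winding-resp-▷ (cong-σ r▷r′)             = ≡.cong -_ (winding-resp-▷ r▷r′)
winding-resp-▷ (cong-τˡ {s = s} r▷r′)    = ≡.cong (_+ winding s) (winding-resp-▷ r▷r′)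
winding-resp-▷ (cong-τʳ {r = r} s▷s′)    = ≡.cong (λ n → winding r + n) (winding-resp-▷ s▷s′)

winding-resp-=rw : ∀ {r s} → r =rw s → winding r ≡ winding s
winding-resp-=rw = gfold ≡.isEquivalence winding winding-resp-▷

_^⁺_ : Path → ℕ → Path
r ^⁺ zero = ρ
r ^⁺ 1+ n = τ r (r ^⁺ n)

loop^ : ℤ → Path
loop^ (+ n)    = loop ^⁺ n
loop^ -[1+ n ] = σ loop ^⁺ 1+ n

winding-loop^ : ∀ z → winding (loop^ z) ≡ z
winding-loop^ (+ zero)    = refl
winding-loop^ (+ 1+ n)    = ≡.cong (λ k → 1ℤ + k) (winding-loop^ (+ n))
winding-loop^ -[1+ zero ] = refl
winding-loop^ -[1+ 1+ n ] = ≡.cong (λ k → - 1ℤ + k) (winding-loop^ -[1+ n ])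

loop^-suc : ∀ z → τ loop (loop^ z) =rw loop^ (suc z)
loop^-suc (+ n)       = rw-refl
loop^-suc -[1+ zero ] = τ-cancelˡ loop ρ
loop^-suc -[1+ 1+ n ] = τ-cancelˡ loop (loop^ -[1+ n ])

loop^-pred : ∀ z → τ (σ loop) (loop^ z) =rw loop^ (pred z)
loop^-pred (+ zero) = rw-refl
loop^-pred (+ 1+ n) = σ-cancelˡ loop (loop^ (+ n))
loop^-pred -[1+ n ] = rw-refl

loop^-+ : ∀ z w → τ (loop^ z) (loop^ w) =rw loop^ (z + w)
loop^-+ (+ zero) w = begin
  τ ρ (loop^ w)  ≈⟨ ▷⇒=rw (τρr (loop^ w)) ⟩
  loop^ w        ≡⟨ ≡.cong loop^ (+-identityˡ w) ⟨
  loop^ (0ℤ + w) ∎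
loop^-+ (+ 1+ n) w = begin
  τ (τ loop (loop^ (+ n))) (loop^ w)  ≈⟨ ▷⇒=rw (ττ loop (loop^ (+ n)) (loop^ w)) ⟩
  τ loop (τ (loop^ (+ n)) (loop^ w))  ≈⟨ τ-congʳ (loop^-+ (+ n) w) ⟩
  τ loop (loop^ (+ n + w))            ≈⟨ loop^-suc (+ n + w) ⟩
  loop^ (suc (+ n + w))               ≡⟨ ≡.cong loop^ (suc-+ n w) ⟨
  loop^ (+ 1+ n + w)                  ∎
loop^-+ -[1+ zero ] w = begin
  τ (τ (σ loop) ρ) (loop^ w)  ≈⟨ τ-congˡ (▷⇒=rw (τrρ (σ loop))) ⟩
  τ (σ loop) (loop^ w)        ≈⟨ loop^-pred w ⟩
  loop^ (pred w)              ∎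
loop^-+ -[1+ 1+ n ] w = begin
  τ (τ (σ loop) (loop^ -[1+ n ])) (loop^ w)  ≈⟨ ▷⇒=rw (ττ (σ loop) (loop^ -[1+ n ]) (loop^ w)) ⟩
  τ (σ loop) (τ (loop^ -[1+ n ]) (loop^ w))  ≈⟨ τ-congʳ (loop^-+ -[1+ n ] w) ⟩
  τ (σ loop) (loop^ (-[1+ n ] + w))          ≈⟨ loop^-pred (-[1+ n ] + w) ⟩
  loop^ (pred (-[1+ n ] + w))                ≡⟨ ≡.cong loop^ (pred-+ -[1+ n ] w) ⟨
  loop^ (-[1+ 1+ n ] + w)                    ∎

loop^-neg : ∀ z → loop^ (- z) =rw σ (loop^ z)
loop^-neg z = inverse-unique (begin
  τ (loop^ z) (loop^ (- z))  ≈⟨ loop^-+ z (- z) ⟩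
  loop^ (z + - z)            ≡⟨ ≡.cong loop^ (+-inverseʳ z) ⟩
  ρ                          ∎)

loop^-winding : ∀ r → loop^ (winding r) =rw r
loop^-winding loop    = ▷⇒=rw (τrρ loop)
loop^-winding ρ       = rw-refl
loop^-winding (σ r)   = begin
  loop^ (- winding r)    ≈⟨ loop^-neg (winding r) ⟩
  σ (loop^ (winding r))  ≈⟨ σ-cong (loop^-winding r) ⟩
  σ r                    ∎
loop^-winding (τ r s) = begin
  loop^ (winding r + winding s)              ≈⟨ loop^-+ (winding r) (winding s) ⟨
  τ (loop^ (winding r)) (loop^ (winding s))  ≈⟨ τ-congˡ (loop^-winding r) ⟩
  τ r (loop^ (winding s))                    ≈⟨ τ-congʳ (loop^-winding s) ⟩
  τ r s                                      ∎

theorem5p17 : Inverse Π₁S¹ (setoid ℤ)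
theorem5p17 = record
  { to        = winding
  ; from      = loop^
  ; to-cong   = winding-resp-=rw
  ; from-cong = λ z≡w → ≡⇒=rw (≡.cong loop^ z≡w)
  ; inverse   = (λ {z} r=loop^z → ≡.trans (winding-resp-=rw r=loop^z) (winding-loop^ z))
              , (λ { {r} refl → loop^-winding r })
  }
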